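{- Let $k_L$ be a finite field of characteristic $p$ and let $\phi$ be the $k_L$-linear ring endomorphism of $k_L[\![X]\!]$ with $\phi(X)=X^p$, acting entrywise on matrices. If $Q\in\mathrm{GL}_2(k_L[\![X]\!])$, then there exists $M\in\mathrm{Id}+X\cdot\mathrm{M}_2(k_L[\![X]\!])$ such that $M^{ -1}Q\,\phi(M)=Q(0)$.
   Context: $Q(0)$ denotes the constant term of $Q$ (evaluation at $X=0$). The map $\phi$ is the reduction modulo $p$ of $X\mapsto(1+X)^p-1$. -}

module Defs where

open import Level using (Level; _⊔_)
open import Algebra.Bundles using (CommutativeRing)
open import Data.Nat using (ℕ; zero; suc; _∸_)
open import Data.Nat.Divisibility using (_∣_; _∣?_; divides)
open import Data.Nat.Primality using (Prime)
open import Data.List using (List)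
open import Data.List.Relation.Unary.Any using (Any)
open import Data.Product using (Σ; _×_)
open import Relation.Nullary using (¬_; yes; no)

record IsFieldCR {c ℓ : Level} (R : CommutativeRing c ℓ) : Set (c ⊔ ℓ) where
  open CommutativeRing R hiding (zero)
  field
    0≉1     : ¬ (0# ≈ 1#)
    inverse : ∀ x → ¬ (x ≈ 0#) → Σ Carrier (λ y → x * y ≈ 1#)

module _ {c ℓ : Level} (R : CommutativeRing c ℓ) where
  open CommutativeRing R hiding (zero)

  IsFinite : Set (c ⊔ ℓ)
  IsFinite = Σ (List Carrier) (λ xs → ∀ x → Any (x ≈_) xs)

  natR : ℕ → Carrier
  natR zero    = 0#
  natR (suc n) = 1# + natR n

  HasCharacteristic : ℕ → Set ℓ
  HasCharacteristic p = natR p ≈ 0#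

  -- formal power series R[[X]] : coefficient sequences
  PS : Set c
  PS = ℕ → Carrier

  infix 4 _≈ₛ_
  _≈ₛ_ : PS → PS → Set ℓ
  f ≈ₛ g = ∀ n → f n ≈ g n

  0ₛ 1ₛ : PS
  0ₛ n = 0#
  1ₛ zero    = 1#
  1ₛ (suc n) = 0#

  const : Carrier → PS
  const a zero    = a
  const a (suc n) = 0#

  infixl 6 _+ₛ_
  infixl 7 _*ₛ_
  _+ₛ_ : PS → PS → PS
  (f +ₛ g) n = f n + g n

  -- Σ_{i=0}^{n} h i (n - i)
  convSum : (ℕ → ℕ → Carrier) → ℕ → Carrier
  convSum h zero    = h zero zero
  convSum h (suc n) = h zero (suc n) + convSum (λ i j → h (suc i) j) n

  _*ₛ_ : PS → PS → PS
  (f *ₛ g) n = convSum (λ i j → f i * g j) n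

  -- φ : the R-linear endomorphism with X ↦ X^p : Σ aₙ Xⁿ ↦ Σ aₙ X^(p n)
  phiₛ : ℕ → PS → PS
  phiₛ p f n with p ∣? n
  ... | yes (divides q _) = f q
  ... | no _              = 0#

  record Mat2 : Set c where
    constructor mat
    field
      a₁₁ a₁₂ a₂₁ a₂₂ : PS
  open Mat2 public

  infix 4 _≈ₘ_
  _≈ₘ_ : Mat2 → Mat2 → Set ℓ
  A ≈ₘ B = (a₁₁ A ≈ₛ a₁₁ B) × (a₁₂ A ≈ₛ a₁₂ B) × (a₂₁ A ≈ₛ a₂₁ B) × (a₂₂ A ≈ₛ a₂₂ B)

  _*ₘ_ : Mat2 → Mat2 → Mat2
  A *ₘ B = mat (a₁₁ A *ₛ a₁₁ B +ₛ a₁₂ A *ₛ a₂₁ B)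
               (a₁₁ A *ₛ a₁₂ B +ₛ a₁₂ A *ₛ a₂₂ B)
               (a₂₁ A *ₛ a₁₁ B +ₛ a₂₂ A *ₛ a₂₁ B)
               (a₂₁ A *ₛ a₁₂ B +ₛ a₂₂ A *ₛ a₂₂ B)

  Idₘ : Mat2
  Idₘ = mat 1ₛ 0ₛ 0ₛ 1ₛ

  phiₘ : ℕ → Mat2 → Mat2
  phiₘ p A = mat (phiₛ p (a₁₁ A)) (phiₛ p (a₁₂ A)) (phiₛ p (a₂₁ A)) (phiₛ p (a₂₂ A))

  at0 : Mat2 → Mat2
  at0 A = mat (const (a₁₁ A 0)) (const (a₁₂ A 0)) (const (a₂₁ A 0)) (const (a₂₂ A 0))

  IsInverse : Mat2 → Mat2 → Set ℓ
  IsInverse A B = ((A *ₘ B) ≈ₘ Idₘ) × ((B *ₘ A) ≈ₘ Idₘ)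

  InGL2 : Mat2 → Set (c ⊔ ℓ)
  InGL2 A = Σ Mat2 (λ B → IsInverse A B)

  -- A ∈ Id + X · M₂(R[[X]]) : constant term of A is the identity
  InId+XM2 : Mat2 → Set ℓ
  InId+XM2 A = at0 A ≈ₘ Idₘ

{-# OPTIONS --safe #-}
-- Rewriting M⁻¹ Q φ(M) = Q(0) as M = Q φ(M) Q(0)⁻¹, M is sought as a fixed point of
-- F(N) = Q φ(N) Q(0)⁻¹. Since φ substitutes X^p for X with p > 1, F is X-adically contracting
-- (N ≡ N′ mod X^(n+1) implies F N ≡ F N′ mod X^(n+2)) and F(Id) ≡ Id mod X, so the iterates of F
-- from Id stabilise coefficientwise and their diagonal is a fixed point M ≡ Id mod X.
-- M is invertible: det M has constant term 1, hence is a unit of k[[X]] (its inverse being the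
-- fixed point of the contraction g ↦ 1 + (1 - det M) g), and adj(M) / det M inverts M.
module Submission where

open import Defs hiding (_≈ₛ_; 0ₛ; 1ₛ; _+ₛ_; _*ₛ_; _≈ₘ_; _*ₘ_; Idₘ; phiₘ; at0)
open import Level using (Level; _⊔_)
open import Algebra.Bundles using (CommutativeRing)
import Algebra.Construct.Pointwise as Pointwise
import Algebra.Properties.Ring
open import Data.Nat as ℕ
  using (ℕ; zero; suc; _<_; _≤_; _≤′_; ≤′-refl; ≤′-step; s≤s; z≤n; NonZero; nonTrivial⇒n>1)
open import Data.Nat.Primality using (Prime; prime)
open import Data.Nat.Properties
  using (≤-pred; ≤⇒≤′; ≤′⇒≤; n<1+n; m<n⇒m<1+n; <-≤-trans; ≤-<-trans; m≤m+n; m≤n+m; *-cancelʳ-<; m<m*n)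
import Data.Nat.Properties as ℕₚ
open import Data.Nat.Divisibility using (_∣?_; divides; _∣0)
open import Data.Product using (Σ; _×_; _,_; proj₁; proj₂)
open import Data.Product.Relation.Binary.Pointwise.NonDependent using (_×ₛ_)
open import Relation.Binary.Bundles using (Setoid)
open import Relation.Binary.PropositionalEquality as ≡ using (_≡_)
open import Relation.Nullary using (yes; no; contradiction)

module Truncated {s ℓ} (S : Setoid s ℓ) where
  open Setoid S

  infix 4 _≈[_]_
  _≈[_]_ : (ℕ → Carrier) → ℕ → (ℕ → Carrier) → Set ℓ
  f ≈[ n ] g = ∀ {m} → m < n → f m ≈ g m

  ≈[]-refl : ∀ f {n} → f ≈[ n ] f
  ≈[]-refl f _ = refl

  ≈[]-trans : ∀ {f g h n} → f ≈[ n ] g → g ≈[ n ] h → f ≈[ n ] h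
  ≈[]-trans f≈g g≈h m<n = trans (f≈g m<n) (g≈h m<n)

  ≈[]-weaken : ∀ {f g m n} → m ≤ n → f ≈[ n ] g → f ≈[ m ] g
  ≈[]-weaken m≤n f≈g i<m = f≈g (<-≤-trans i<m m≤n)

  Contracting : ((ℕ → Carrier) → ℕ → Carrier) → Set (s ⊔ ℓ)
  Contracting F = ∀ {n f g} → f ≈[ suc n ] g → F f ≈[ suc (suc n) ] F g

  module FixedPoint (F : (ℕ → Carrier) → ℕ → Carrier) (F-contracting : Contracting F)
                    (x₀ : ℕ → Carrier) (x₀≈Fx₀ : x₀ ≈[ 1 ] F x₀) where

    iterate : ℕ → ℕ → Carrier
    iterate zero    = x₀
    iterate (suc r) = F (iterate r)

    iterate-suc : ∀ r → iterate r ≈[ suc r ] iterate (suc r)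
    iterate-suc zero    = x₀≈Fx₀
    iterate-suc (suc r) = F-contracting (iterate-suc r)

    iterate-≤′ : ∀ {m n} → m ≤′ n → iterate m ≈[ suc m ] iterate n
    iterate-≤′ {m} ≤′-refl     = ≈[]-refl (iterate m)
    iterate-≤′ (≤′-step m≤′n) =
      ≈[]-trans (iterate-≤′ m≤′n) (≈[]-weaken (s≤s (≤′⇒≤ m≤′n)) (iterate-suc _))

    fix : ℕ → Carrier
    fix n = iterate n n

    fix≈iterate : ∀ n → fix ≈[ suc n ] iterate n
    fix≈iterate n {m} m<1+n = iterate-≤′ (≤⇒≤′ (≤-pred m<1+n)) (n<1+n m)

    fix-isFixedPoint : ∀ n → fix n ≈ F fix n
    fix-isFixedPoint n =
      trans (iterate-suc n (n<1+n n)) (sym (F-contracting (fix≈iterate n) (m<n⇒m<1+n (n<1+n n))))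

module PowerSeries {c ℓ} (k : CommutativeRing c ℓ) where
  open CommutativeRing k hiding (zero)
  open import Algebra.Properties.CommutativeSemigroup +-commutativeSemigroup using (interchange)
  open Truncated setoid public

  infix  4 _≈ₛ_
  infixl 6 _+ₛ_
  infixl 7 _*ₛ_
  infix  8 -ₛ_

  _≈ₛ_ : PS k → PS k → Set ℓ
  _≈ₛ_ = Defs._≈ₛ_ k

  0ₛ 1ₛ : PS k
  0ₛ = Defs.0ₛ k
  1ₛ = Defs.1ₛ k

  _+ₛ_ _*ₛ_ : PS k → PS k → PS k
  _+ₛ_ = Defs._+ₛ_ k
  _*ₛ_ = Defs._*ₛ_ k

  -ₛ_ : PS k → PS k
  (-ₛ f) n = - f n

  convSum-cong : ∀ n {h h′ : ℕ → ℕ → Carrier} →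
                 (∀ {i j} → i ℕ.+ j ≡ n → h i j ≈ h′ i j) → convSum k h n ≈ convSum k h′ n
  convSum-cong zero    h≈h′ = h≈h′ ≡.refl
  convSum-cong (suc n) h≈h′ = +-cong (h≈h′ ≡.refl) (convSum-cong n (λ e → h≈h′ (≡.cong suc e)))

  convSum-zero : ∀ n {h : ℕ → ℕ → Carrier} → (∀ i j → h i j ≈ 0#) → convSum k h n ≈ 0#
  convSum-zero zero    h≈0 = h≈0 0 0
  convSum-zero (suc n) h≈0 =
    trans (+-cong (h≈0 0 (suc n)) (convSum-zero n (λ i → h≈0 (suc i)))) (+-identityʳ 0#)

  convSum-+ : ∀ n (h g : ℕ → ℕ → Carrier) →
              convSum k (λ i j → h i j + g i j) n ≈ convSum k h n + convSum k g n
  convSum-+ zero    h g = refl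
  convSum-+ (suc n) h g = trans (+-cong refl (convSum-+ n _ _)) (interchange _ _ _ _)

  convSum-*ˡ : ∀ n a (h : ℕ → ℕ → Carrier) → a * convSum k h n ≈ convSum k (λ i j → a * h i j) n
  convSum-*ˡ zero    a h = refl
  convSum-*ˡ (suc n) a h = trans (distribˡ _ _ _) (+-cong refl (convSum-*ˡ n a _))

  convSum-*ʳ : ∀ n a (h : ℕ → ℕ → Carrier) → convSum k h n * a ≈ convSum k (λ i j → h i j * a) n
  convSum-*ʳ zero    a h = refl
  convSum-*ʳ (suc n) a h = trans (distribʳ _ _ _) (+-cong refl (convSum-*ʳ n a _))

  convSum-last : ∀ n (h : ℕ → ℕ → Carrier) →
                 convSum k h (suc n) ≈ convSum k (λ i j → h i (suc j)) n + h (suc n) 0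
  convSum-last zero    h = refl
  convSum-last (suc n) h = trans (+-cong refl (convSum-last n (λ i → h (suc i)))) (sym (+-assoc _ _ _))

  convSum-swap : ∀ n (h : ℕ → ℕ → Carrier) → convSum k h n ≈ convSum k (λ i j → h j i) n
  convSum-swap zero    h = refl
  convSum-swap (suc n) h = trans (convSum-last n h) (trans (+-cong (convSum-swap n _) refl) (+-comm _ _))

  convSum-assoc : ∀ n (h : ℕ → ℕ → ℕ → Carrier) →
    convSum k (λ i l → convSum k (λ a b → h a b l) i) n ≈ convSum k (λ a m → convSum k (h a) m) n
  convSum-assoc zero    h = refl
  convSum-assoc (suc n) h = begin
    h 0 0 (suc n) + convSum k (λ i l → convSum k (λ a b → h a b l) (suc i)) n
      ≈⟨ +-cong refl (convSum-+ n _ _) ⟩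
    h 0 0 (suc n) + (convSum k (λ i l → h 0 (suc i) l) n
                     + convSum k (λ i l → convSum k (λ a b → h (suc a) b l) i) n)
      ≈⟨ +-cong refl (+-cong refl (convSum-assoc n (λ a → h (suc a)))) ⟩
    h 0 0 (suc n) + (convSum k (λ i l → h 0 (suc i) l) n
                     + convSum k (λ a m → convSum k (h (suc a)) m) n)
      ≈⟨ sym (+-assoc _ _ _) ⟩
    convSum k (h 0) (suc n) + convSum k (λ a m → convSum k (h (suc a)) m) n ∎
    where open import Relation.Binary.Reasoning.Setoid setoid

  *ₛ-cong : ∀ {f f′ g g′} → f ≈ₛ f′ → g ≈ₛ g′ → f *ₛ g ≈ₛ f′ *ₛ g′
  *ₛ-cong f≈f′ g≈g′ n = convSum-cong n (λ _ → *-cong (f≈f′ _) (g≈g′ _))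

  *ₛ-assoc : ∀ f g h → (f *ₛ g) *ₛ h ≈ₛ f *ₛ (g *ₛ h)
  *ₛ-assoc f g h n = begin
    convSum k (λ i l → convSum k (λ a b → f a * g b) i * h l) n
      ≈⟨ convSum-cong n (λ {i} {l} _ → convSum-*ʳ i (h l) _) ⟩
    convSum k (λ i l → convSum k (λ a b → (f a * g b) * h l) i) n
      ≈⟨ convSum-assoc n (λ a b l → (f a * g b) * h l) ⟩
    convSum k (λ a m → convSum k (λ b l → (f a * g b) * h l) m) n
      ≈⟨ convSum-cong n (λ {a} {m} _ → trans (convSum-cong m (λ _ → *-assoc _ _ _))
                                             (sym (convSum-*ˡ m (f a) _))) ⟩
    convSum k (λ a m → f a * convSum k (λ b l → g b * h l) m) n ∎
    where open import Relation.Binary.Reasoning.Setoid setoid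

  *ₛ-comm : ∀ f g → f *ₛ g ≈ₛ g *ₛ f
  *ₛ-comm f g n = trans (convSum-swap n _) (convSum-cong n (λ _ → *-comm _ _))

  *ₛ-identityˡ : ∀ f → 1ₛ *ₛ f ≈ₛ f
  *ₛ-identityˡ f zero    = *-identityˡ (f 0)
  *ₛ-identityˡ f (suc n) =
    trans (+-cong (*-identityˡ _) (convSum-zero n (λ _ j → zeroˡ (f j)))) (+-identityʳ _)

  *ₛ-distribˡ : ∀ f g h → f *ₛ (g +ₛ h) ≈ₛ f *ₛ g +ₛ f *ₛ h
  *ₛ-distribˡ f g h n = trans (convSum-cong n (λ _ → distribˡ _ _ _)) (convSum-+ n _ _)

  *ₛ-distribʳ : ∀ f g h → (g +ₛ h) *ₛ f ≈ₛ g *ₛ f +ₛ h *ₛ f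
  *ₛ-distribʳ f g h n = trans (convSum-cong n (λ _ → distribʳ _ _ _)) (convSum-+ n _ _)

  PSRing : CommutativeRing c ℓ
  PSRing = record
    { Carrier           = PS k
    ; _≈_               = _≈ₛ_
    ; _+_               = _+ₛ_
    ; _*_               = _*ₛ_
    ; -_                = -ₛ_
    ; 0#                = 0ₛ
    ; 1#                = 1ₛ
    ; isCommutativeRing = record
      { isRing = record
        { +-isAbelianGroup = Pointwise.isAbelianGroup ℕ +-isAbelianGroup
        ; *-cong           = *ₛ-cong
        ; *-assoc          = *ₛ-assoc
        ; *-identity       = *ₛ-identityˡ , λ f n → trans (*ₛ-comm f 1ₛ n) (*ₛ-identityˡ f n)
        ; distrib          = *ₛ-distribˡ , *ₛ-distribʳ
        }
      ; *-comm = *ₛ-comm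
      }
    }

  +ₛ-cong-≈[] : ∀ {f f′ g g′ n} → f ≈[ n ] f′ → g ≈[ n ] g′ → f +ₛ g ≈[ n ] f′ +ₛ g′
  +ₛ-cong-≈[] f≈f′ g≈g′ m<n = +-cong (f≈f′ m<n) (g≈g′ m<n)

  private
    left-summand-< : ∀ {i j m n} → i ℕ.+ j ≡ m → m < n → i < n
    left-summand-< {i} {j} e = ≤-<-trans (≡.subst (i ≤_) e (m≤m+n i j))

    right-summand-< : ∀ {i j m n} → i ℕ.+ j ≡ m → m < n → j < n
    right-summand-< {i} {j} e = ≤-<-trans (≡.subst (j ≤_) e (m≤n+m j i))

  *ₛ-cong-≈[] : ∀ {f f′ g g′ n} → f ≈[ n ] f′ → g ≈[ n ] g′ → f *ₛ g ≈[ n ] f′ *ₛ g′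
  *ₛ-cong-≈[] f≈f′ g≈g′ {m} m<n =
    convSum-cong m (λ e → *-cong (f≈f′ (left-summand-< e m<n)) (g≈g′ (right-summand-< e m<n)))

  private
    zero-factor : ∀ {x} y z → x ≈ 0# → x * y ≈ x * z
    zero-factor y z x≈0 =
      trans (*-cong x≈0 refl) (trans (zeroˡ y) (sym (trans (*-cong x≈0 refl) (zeroˡ z))))

  *ₛ-contract-≈[] : ∀ {h g g′ n} → h 0 ≈ 0# → g ≈[ n ] g′ → h *ₛ g ≈[ suc n ] h *ₛ g′
  *ₛ-contract-≈[] h0≈0 g≈g′ {zero}  _         = zero-factor _ _ h0≈0
  *ₛ-contract-≈[] h0≈0 g≈g′ {suc m} (s≤s m<n) =
    +-cong (zero-factor _ _ h0≈0) (convSum-cong m (λ e → *-cong refl (g≈g′ (right-summand-< e m<n))))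

  phiₛ-cong-≈[] : ∀ p {f g n} → f ≈[ n ] g → phiₛ k p f ≈[ n ℕ.* p ] phiₛ k p g
  phiₛ-cong-≈[] p {n = n} f≈g {m} m<np with p ∣? m
  ... | yes (divides q m≡qp) = f≈g (*-cancelʳ-< p q n (≡.subst (_< n ℕ.* p) m≡qp m<np))
  ... | no _ = refl

  phiₛ-contracting : ∀ {p} → 1 < p → Contracting (phiₛ k p)
  phiₛ-contracting {p} p>1 {n} f≈g = ≈[]-weaken (m<m*n (suc n) p p>1) (phiₛ-cong-≈[] p f≈g)

  phiₛ-constantTerm : ∀ p .{{_ : NonZero p}} f → phiₛ k p f 0 ≈ f 0
  phiₛ-constantTerm p f with p ∣? 0
  ... | yes (divides q 0≡qp) = reflexive (≡.cong f (ℕₚ.m*n≡0⇒m≡0 q p (≡.sym 0≡qp)))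
  ... | no p∤0 = contradiction (p ∣0) p∤0

  const-cong : ∀ {a b} → a ≈ b → const k a ≈ₛ const k b
  const-cong a≈b zero    = a≈b
  const-cong a≈b (suc n) = refl

  const-+ₛ : ∀ a b → const k a +ₛ const k b ≈ₛ const k (a + b)
  const-+ₛ a b zero    = refl
  const-+ₛ a b (suc n) = +-identityʳ 0#

  const-*ₛ : ∀ a b → const k a *ₛ const k b ≈ₛ const k (a * b)
  const-*ₛ a b zero    = refl
  const-*ₛ a b (suc n) = trans (+-cong (zeroʳ a) (convSum-zero n (λ _ _ → zeroˡ _))) (+-identityʳ 0#)

  const-dot : ∀ a b c d → const k a *ₛ const k b +ₛ const k c *ₛ const k d ≈ₛ const k (a * b + c * d)
  const-dot a b c d n = trans (+-cong (const-*ₛ a b n) (const-*ₛ c d n)) (const-+ₛ (a * b) (c * d) n)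

  const-0# : const k 0# ≈ₛ 0ₛ
  const-0# zero    = refl
  const-0# (suc n) = refl

  const-1# : const k 1# ≈ₛ 1ₛ
  const-1# zero    = refl
  const-1# (suc n) = refl

  *ₛ-invertible : ∀ f → f 0 ≈ 1# → Σ (PS k) (λ g → f *ₛ g ≈ₛ 1ₛ)
  *ₛ-invertible f f0≈1 = fix , PSR.+-cancelʳ (e *ₛ fix) (f *ₛ fix) 1ₛ f*fix+e*fix≈1+e*fix
    where
    module PSR where
      open CommutativeRing PSRing public
      open Algebra.Properties.Ring (CommutativeRing.ring PSRing) public

    e : PS k
    e = 1ₛ +ₛ -ₛ f

    e0≈0 : e 0 ≈ 0#
    e0≈0 = trans (+-cong refl (-‿cong f0≈1)) (-‿inverseʳ 1#)

    G : PS k → PS k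
    G g = 1ₛ +ₛ e *ₛ g

    G1≈1 : 1ₛ ≈[ 1 ] G 1ₛ
    G1≈1 (s≤s z≤n) = sym (trans (+-cong refl (trans (*-cong e0≈0 refl) (zeroˡ 1#))) (+-identityʳ 1#))

    open FixedPoint G (λ g≈g′ → +ₛ-cong-≈[] (≈[]-refl 1ₛ) (*ₛ-contract-≈[] e0≈0 g≈g′)) 1ₛ G1≈1

    f*fix+e*fix≈1+e*fix : f *ₛ fix +ₛ e *ₛ fix ≈ₛ 1ₛ +ₛ e *ₛ fix
    f*fix+e*fix≈1+e*fix = begin
      f *ₛ fix +ₛ e *ₛ fix       ≈⟨ *ₛ-distribʳ fix f e ⟨
      (f +ₛ e) *ₛ fix            ≈⟨ PSR.*-congʳ (PSR.+-assoc f 1ₛ (-ₛ f)) ⟨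
      (f +ₛ 1ₛ +ₛ -ₛ f) *ₛ fix   ≈⟨ PSR.*-congʳ (PSR.xyx⁻¹≈y f 1ₛ) ⟩
      1ₛ *ₛ fix                  ≈⟨ *ₛ-identityˡ fix ⟩
      fix                        ≈⟨ fix-isFixedPoint ⟩
      1ₛ +ₛ e *ₛ fix             ∎
      where open import Relation.Binary.Reasoning.Setoid PSR.setoid

module Matrices {c ℓ} (k : CommutativeRing c ℓ) where
  open PowerSeries k
  open CommutativeRing PSRing
  open import Algebra.Properties.Ring ring using (-‿distribˡ-*; -‿distribʳ-*)
  open import Algebra.Solver.Ring.NaturalCoefficients.Default commutativeSemiring
  module K = CommutativeRing k

  infix  4 _≈ₘ_
  infixl 7 _*ₘ_

  _≈ₘ_ : Mat2 k → Mat2 k → Set ℓ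
  _≈ₘ_ = Defs._≈ₘ_ k

  _*ₘ_ : Mat2 k → Mat2 k → Mat2 k
  _*ₘ_ = Defs._*ₘ_ k

  Idₘ : Mat2 k
  Idₘ = Defs.Idₘ k

  phiₘ : ℕ → Mat2 k → Mat2 k
  phiₘ = Defs.phiₘ k

  at0 : Mat2 k → Mat2 k
  at0 = Defs.at0 k

  ≈ₘ-setoid : Setoid c ℓ
  ≈ₘ-setoid = record
    { Carrier       = Mat2 k
    ; _≈_           = _≈ₘ_
    ; isEquivalence = record
      { refl  = refl , refl , refl , refl
      ; sym   = λ (e₁ , e₂ , e₃ , e₄) → sym e₁ , sym e₂ , sym e₃ , sym e₄
      ; trans = λ (e₁ , e₂ , e₃ , e₄) (f₁ , f₂ , f₃ , f₄) →
                  trans e₁ f₁ , trans e₂ f₂ , trans e₃ f₃ , trans e₄ f₄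
      }
    }

  *ₘ-cong : ∀ {A A′ B B′} → A ≈ₘ A′ → B ≈ₘ B′ → A *ₘ B ≈ₘ A′ *ₘ B′
  *ₘ-cong (a₁ , a₂ , a₃ , a₄) (b₁ , b₂ , b₃ , b₄) =
    +-cong (*-cong a₁ b₁) (*-cong a₂ b₃) , +-cong (*-cong a₁ b₂) (*-cong a₂ b₄) ,
    +-cong (*-cong a₃ b₁) (*-cong a₄ b₃) , +-cong (*-cong a₃ b₂) (*-cong a₄ b₄)

  private
    row-col-assoc : ∀ x₁ x₂ y₁₁ y₁₂ y₂₁ y₂₂ z₁ z₂ →
      (x₁ * y₁₁ + x₂ * y₂₁) * z₁ + (x₁ * y₁₂ + x₂ * y₂₂) * z₂ ≈
      x₁ * (y₁₁ * z₁ + y₁₂ * z₂) + x₂ * (y₂₁ * z₁ + y₂₂ * z₂)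
    row-col-assoc = solve 8 (λ x₁ x₂ y₁₁ y₁₂ y₂₁ y₂₂ z₁ z₂ →
      (x₁ :* y₁₁ :+ x₂ :* y₂₁) :* z₁ :+ (x₁ :* y₁₂ :+ x₂ :* y₂₂) :* z₂ :=
      x₁ :* (y₁₁ :* z₁ :+ y₁₂ :* z₂) :+ x₂ :* (y₂₁ :* z₁ :+ y₂₂ :* z₂)) refl

    1x+0y≈x : ∀ x y → 1# * x + 0# * y ≈ x
    1x+0y≈x = solve 2 (λ x y → con 1 :* x :+ con 0 :* y := x) refl

    0x+1y≈y : ∀ x y → 0# * x + 1# * y ≈ y
    0x+1y≈y = solve 2 (λ x y → con 0 :* x :+ con 1 :* y := y) refl

    x1+y0≈x : ∀ x y → x * 1# + y * 0# ≈ x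
    x1+y0≈x = solve 2 (λ x y → x :* con 1 :+ y :* con 0 := x) refl

    x0+y1≈y : ∀ x y → x * 0# + y * 1# ≈ y
    x0+y1≈y = solve 2 (λ x y → x :* con 0 :+ y :* con 1 := y) refl

  *ₘ-assoc : ∀ A B C → (A *ₘ B) *ₘ C ≈ₘ A *ₘ (B *ₘ C)
  *ₘ-assoc (mat x₁₁ x₁₂ x₂₁ x₂₂) (mat y₁₁ y₁₂ y₂₁ y₂₂) (mat z₁₁ z₁₂ z₂₁ z₂₂) =
    row-col-assoc x₁₁ x₁₂ y₁₁ y₁₂ y₂₁ y₂₂ z₁₁ z₂₁ , row-col-assoc x₁₁ x₁₂ y₁₁ y₁₂ y₂₁ y₂₂ z₁₂ z₂₂ ,
    row-col-assoc x₂₁ x₂₂ y₁₁ y₁₂ y₂₁ y₂₂ z₁₁ z₂₁ , row-col-assoc x₂₁ x₂₂ y₁₁ y₁₂ y₂₁ y₂₂ z₁₂ z₂₂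

  *ₘ-identityˡ : ∀ A → Idₘ *ₘ A ≈ₘ A
  *ₘ-identityˡ (mat x₁₁ x₁₂ x₂₁ x₂₂) =
    1x+0y≈x x₁₁ x₂₁ , 1x+0y≈x x₁₂ x₂₂ , 0x+1y≈y x₁₁ x₂₁ , 0x+1y≈y x₁₂ x₂₂

  *ₘ-identityʳ : ∀ A → A *ₘ Idₘ ≈ₘ A
  *ₘ-identityʳ (mat x₁₁ x₁₂ x₂₁ x₂₂) =
    x1+y0≈x x₁₁ x₁₂ , x0+y1≈y x₁₁ x₁₂ , x1+y0≈x x₂₁ x₂₂ , x0+y1≈y x₂₁ x₂₂

  det : Mat2 k → PS k
  det A = a₁₁ A * a₂₂ A - a₁₂ A * a₂₁ A

  adjugate : Mat2 k → Mat2 k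
  adjugate A = mat (a₂₂ A) (- a₁₂ A) (- a₂₁ A) (a₁₁ A)

  scalar : PS k → Mat2 k
  scalar d = mat d 0# 0# d

  scale : PS k → Mat2 k → Mat2 k
  scale u A = mat (a₁₁ A * u) (a₁₂ A * u) (a₂₁ A * u) (a₂₂ A * u)

  private
    x[-y]+yx≈0 : ∀ x y → x * - y + y * x ≈ 0#
    x[-y]+yx≈0 x y = trans (+-cong (sym (-‿distribʳ-* x y)) (*-comm y x)) (-‿inverseˡ (x * y))

    [-x]y+yx≈0 : ∀ x y → - x * y + y * x ≈ 0#
    [-x]y+yx≈0 x y = trans (+-cong (sym (-‿distribˡ-* x y)) (*-comm y x)) (-‿inverseˡ (x * y))

    x[-y]≈-[yx] : ∀ x y → x * - y ≈ - (y * x)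
    x[-y]≈-[yx] x y = trans (sym (-‿distribʳ-* x y)) (-‿cong (*-comm x y))

    [-x]y≈-[yx] : ∀ x y → - x * y ≈ - (y * x)
    [-x]y≈-[yx] x y = trans (sym (-‿distribˡ-* x y)) (-‿cong (*-comm x y))

  *ₘ-adjugate : ∀ A → A *ₘ adjugate A ≈ₘ scalar (det A)
  *ₘ-adjugate (mat a b c d) =
    +-cong refl (sym (-‿distribʳ-* b c)) ,
    x[-y]+yx≈0 a b ,
    trans (+-comm _ _) (x[-y]+yx≈0 d c) ,
    trans (+-comm _ _) (+-cong (*-comm d a) (x[-y]≈-[yx] c b))

  adjugate-*ₘ : ∀ A → adjugate A *ₘ A ≈ₘ scalar (det A)
  adjugate-*ₘ (mat a b c d) =
    +-cong (*-comm d a) (sym (-‿distribˡ-* b c)) ,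
    trans (+-comm _ _) ([-x]y+yx≈0 b d) ,
    [-x]y+yx≈0 c a ,
    trans (+-comm _ _) (+-cong refl ([-x]y≈-[yx] c b))

  private
    x[yu]+z[wu]≈[xy+zw]u : ∀ x y z w u → x * (y * u) + z * (w * u) ≈ (x * y + z * w) * u
    x[yu]+z[wu]≈[xy+zw]u = solve 5 (λ x y z w u →
      x :* (y :* u) :+ z :* (w :* u) := (x :* y :+ z :* w) :* u) refl

    [xu]y+[zu]w≈[xy+zw]u : ∀ x y z w u → (x * u) * y + (z * u) * w ≈ (x * y + z * w) * u
    [xu]y+[zu]w≈[xy+zw]u = solve 5 (λ x y z w u →
      (x :* u) :* y :+ (z :* u) :* w := (x :* y :+ z :* w) :* u) refl

  *ₘ-scale : ∀ u A B → A *ₘ scale u B ≈ₘ scale u (A *ₘ B)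
  *ₘ-scale u (mat x₁₁ x₁₂ x₂₁ x₂₂) (mat y₁₁ y₁₂ y₂₁ y₂₂) =
    x[yu]+z[wu]≈[xy+zw]u x₁₁ y₁₁ x₁₂ y₂₁ u , x[yu]+z[wu]≈[xy+zw]u x₁₁ y₁₂ x₁₂ y₂₂ u ,
    x[yu]+z[wu]≈[xy+zw]u x₂₁ y₁₁ x₂₂ y₂₁ u , x[yu]+z[wu]≈[xy+zw]u x₂₁ y₁₂ x₂₂ y₂₂ u

  scale-*ₘ : ∀ u A B → scale u A *ₘ B ≈ₘ scale u (A *ₘ B)
  scale-*ₘ u (mat x₁₁ x₁₂ x₂₁ x₂₂) (mat y₁₁ y₁₂ y₂₁ y₂₂) =
    [xu]y+[zu]w≈[xy+zw]u x₁₁ y₁₁ x₁₂ y₂₁ u , [xu]y+[zu]w≈[xy+zw]u x₁₁ y₁₂ x₁₂ y₂₂ u ,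
    [xu]y+[zu]w≈[xy+zw]u x₂₁ y₁₁ x₂₂ y₂₁ u , [xu]y+[zu]w≈[xy+zw]u x₂₁ y₁₂ x₂₂ y₂₂ u

  scale-cong : ∀ u {A B} → A ≈ₘ B → scale u A ≈ₘ scale u B
  scale-cong u (e₁ , e₂ , e₃ , e₄) = *-cong e₁ refl , *-cong e₂ refl , *-cong e₃ refl , *-cong e₄ refl

  scale-scalar : ∀ {u d} → d * u ≈ 1# → scale u (scalar d) ≈ₘ Idₘ
  scale-scalar du≈1 = du≈1 , zeroˡ _ , zeroˡ _ , du≈1

  adjugate-inverse : ∀ A u → det A * u ≈ 1# → IsInverse k A (scale u (adjugate A))
  adjugate-inverse A u du≈1 = inverseʳ , inverseˡ
    where
    open import Relation.Binary.Reasoning.Setoid ≈ₘ-setoid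

    inverseʳ : A *ₘ scale u (adjugate A) ≈ₘ Idₘ
    inverseʳ = begin
      A *ₘ scale u (adjugate A)    ≈⟨ *ₘ-scale u A (adjugate A) ⟩
      scale u (A *ₘ adjugate A)    ≈⟨ scale-cong u (*ₘ-adjugate A) ⟩
      scale u (scalar (det A))     ≈⟨ scale-scalar du≈1 ⟩
      Idₘ                          ∎

    inverseˡ : scale u (adjugate A) *ₘ A ≈ₘ Idₘ
    inverseˡ = begin
      scale u (adjugate A) *ₘ A    ≈⟨ scale-*ₘ u (adjugate A) A ⟩
      scale u (adjugate A *ₘ A)    ≈⟨ scale-cong u (adjugate-*ₘ A) ⟩
      scale u (scalar (det A))     ≈⟨ scale-scalar du≈1 ⟩
      Idₘ                          ∎

  det-constantTerm : ∀ A → InId+XM2 k A → det A 0 K.≈ K.1#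
  det-constantTerm A (e₁₁ , e₁₂ , e₂₁ , e₂₂) = begin
    a₁₁ A 0 K.* a₂₂ A 0 K.+ K.- (a₁₂ A 0 K.* a₂₁ A 0)
      ≈⟨ K.+-cong (K.*-cong (e₁₁ 0) (e₂₂ 0)) (K.-‿cong (K.*-cong (e₁₂ 0) (e₂₁ 0))) ⟩
    K.1# K.* K.1# K.+ K.- (K.0# K.* K.0#)
      ≈⟨ K.+-cong (K.*-identityˡ K.1#) (K.trans (K.-‿cong (K.zeroˡ K.0#)) -0#≈0#) ⟩
    K.1# K.+ K.0#
      ≈⟨ K.+-identityʳ K.1# ⟩
    K.1# ∎
    where
    open import Relation.Binary.Reasoning.Setoid K.setoid
    open import Algebra.Properties.Ring K.ring using (-0#≈0#)

  InId+XM2⇒InGL2 : ∀ A → InId+XM2 k A → InGL2 k A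
  InId+XM2⇒InGL2 A A∈Id+XM2 =
    let u , det[A]*u≈1 = *ₛ-invertible (det A) (det-constantTerm A A∈Id+XM2)
    in scale u (adjugate A) , adjugate-inverse A u det[A]*u≈1

  at0-cong : ∀ {A B} → A ≈ₘ B → at0 A ≈ₘ at0 B
  at0-cong (e₁ , e₂ , e₃ , e₄) =
    const-cong (e₁ 0) , const-cong (e₂ 0) , const-cong (e₃ 0) , const-cong (e₄ 0)

  at0-*ₘ : ∀ A B → at0 (A *ₘ B) ≈ₘ at0 A *ₘ at0 B
  at0-*ₘ (mat x₁₁ x₁₂ x₂₁ x₂₂) (mat y₁₁ y₁₂ y₂₁ y₂₂) =
    sym (const-dot (x₁₁ 0) (y₁₁ 0) (x₁₂ 0) (y₂₁ 0)) , sym (const-dot (x₁₁ 0) (y₁₂ 0) (x₁₂ 0) (y₂₂ 0)) ,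
    sym (const-dot (x₂₁ 0) (y₁₁ 0) (x₂₂ 0) (y₂₁ 0)) , sym (const-dot (x₂₁ 0) (y₁₂ 0) (x₂₂ 0) (y₂₂ 0))

  at0-Idₘ : at0 Idₘ ≈ₘ Idₘ
  at0-Idₘ = const-1# , const-0# , const-0# , const-1#

  at0-phiₘ : ∀ p .{{_ : NonZero p}} A → at0 (phiₘ p A) ≈ₘ at0 A
  at0-phiₘ p (mat x₁₁ x₁₂ x₂₁ x₂₂) =
    const-cong (phiₛ-constantTerm p x₁₁) , const-cong (phiₛ-constantTerm p x₁₂) ,
    const-cong (phiₛ-constantTerm p x₂₁) , const-cong (phiₛ-constantTerm p x₂₂)

  at0-inverse : ∀ {A B} → IsInverse k A B → IsInverse k (at0 A) (at0 B)
  at0-inverse (AB≈I , BA≈I) = at0-product-≈Id AB≈I , at0-product-≈Id BA≈I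
    where
    open import Relation.Binary.Reasoning.Setoid ≈ₘ-setoid
    at0-product-≈Id : ∀ {C D} → C *ₘ D ≈ₘ Idₘ → at0 C *ₘ at0 D ≈ₘ Idₘ
    at0-product-≈Id {C} {D} CD≈I = begin
      at0 C *ₘ at0 D  ≈⟨ at0-*ₘ C D ⟨
      at0 (C *ₘ D)    ≈⟨ at0-cong CD≈I ⟩
      at0 Idₘ         ≈⟨ at0-Idₘ ⟩
      Idₘ             ∎

  infix 4 _≈[_]ₘ_
  _≈[_]ₘ_ : Mat2 k → ℕ → Mat2 k → Set ℓ
  A ≈[ n ]ₘ B =
    (a₁₁ A ≈[ n ] a₁₁ B) × (a₁₂ A ≈[ n ] a₁₂ B) × (a₂₁ A ≈[ n ] a₂₁ B) × (a₂₂ A ≈[ n ] a₂₂ B)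

  ≈[]ₘ-refl : ∀ A {n} → A ≈[ n ]ₘ A
  ≈[]ₘ-refl A = ≈[]-refl (a₁₁ A) , ≈[]-refl (a₁₂ A) , ≈[]-refl (a₂₁ A) , ≈[]-refl (a₂₂ A)

  *ₘ-cong-≈[] : ∀ {A A′ B B′ n} → A ≈[ n ]ₘ A′ → B ≈[ n ]ₘ B′ → A *ₘ B ≈[ n ]ₘ A′ *ₘ B′
  *ₘ-cong-≈[] (a₁ , a₂ , a₃ , a₄) (b₁ , b₂ , b₃ , b₄) =
    +ₛ-cong-≈[] (*ₛ-cong-≈[] a₁ b₁) (*ₛ-cong-≈[] a₂ b₃) ,
    +ₛ-cong-≈[] (*ₛ-cong-≈[] a₁ b₂) (*ₛ-cong-≈[] a₂ b₄) ,
    +ₛ-cong-≈[] (*ₛ-cong-≈[] a₃ b₁) (*ₛ-cong-≈[] a₄ b₃) ,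
    +ₛ-cong-≈[] (*ₛ-cong-≈[] a₃ b₂) (*ₛ-cong-≈[] a₄ b₄)

  Contractingₘ : (Mat2 k → Mat2 k) → Set (c ⊔ ℓ)
  Contractingₘ F = ∀ {n A B} → A ≈[ suc n ]ₘ B → F A ≈[ suc (suc n) ]ₘ F B

  phiₘ-contracting : ∀ {p} → 1 < p → Contractingₘ (phiₘ p)
  phiₘ-contracting p>1 (e₁ , e₂ , e₃ , e₄) =
    phiₛ-contracting p>1 e₁ , phiₛ-contracting p>1 e₂ , phiₛ-contracting p>1 e₃ , phiₛ-contracting p>1 e₄

  private
    k⁴ : Setoid c ℓ
    k⁴ = K.setoid ×ₛ (K.setoid ×ₛ (K.setoid ×ₛ K.setoid))

    module T⁴ = Truncated k⁴

    toSeq : Mat2 k → ℕ → Setoid.Carrier k⁴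
    toSeq A n = a₁₁ A n , a₁₂ A n , a₂₁ A n , a₂₂ A n

    fromSeq : (ℕ → Setoid.Carrier k⁴) → Mat2 k
    fromSeq s = mat (λ n → proj₁ (s n)) (λ n → proj₁ (proj₂ (s n)))
                    (λ n → proj₁ (proj₂ (proj₂ (s n)))) (λ n → proj₂ (proj₂ (proj₂ (s n))))

    ≈[]ₘ⇒≈[]⁴ : ∀ {A B n} → A ≈[ n ]ₘ B → toSeq A T⁴.≈[ n ] toSeq B
    ≈[]ₘ⇒≈[]⁴ (e₁ , e₂ , e₃ , e₄) m<n = e₁ m<n , e₂ m<n , e₃ m<n , e₄ m<n

    ≈[]⁴⇒≈[]ₘ : ∀ {s t n} → s T⁴.≈[ n ] t → fromSeq s ≈[ n ]ₘ fromSeq t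
    ≈[]⁴⇒≈[]ₘ e = (λ m<n → proj₁ (e m<n)) , (λ m<n → proj₁ (proj₂ (e m<n))) ,
                  (λ m<n → proj₁ (proj₂ (proj₂ (e m<n)))) , (λ m<n → proj₂ (proj₂ (proj₂ (e m<n))))

  module MatrixFixedPoint (F : Mat2 k → Mat2 k) (F-contracting : Contractingₘ F)
                          (A₀ : Mat2 k) (at0-A₀≈at0-FA₀ : at0 A₀ ≈ₘ at0 (F A₀)) where

    private
      base : toSeq A₀ T⁴.≈[ 1 ] toSeq (F A₀)
      base (s≤s z≤n) = let (e₁ , e₂ , e₃ , e₄) = at0-A₀≈at0-FA₀ in e₁ 0 , e₂ 0 , e₃ 0 , e₄ 0

      open T⁴.FixedPoint (λ s → toSeq (F (fromSeq s))) (λ e → ≈[]ₘ⇒≈[]⁴ (F-contracting (≈[]⁴⇒≈[]ₘ e)))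
                         (toSeq A₀) base

    fixₘ : Mat2 k
    fixₘ = fromSeq fix

    fixₘ-isFixedPoint : fixₘ ≈ₘ F fixₘ
    fixₘ-isFixedPoint =
      (λ n → proj₁ (fix-isFixedPoint n)) , (λ n → proj₁ (proj₂ (fix-isFixedPoint n))) ,
      (λ n → proj₁ (proj₂ (proj₂ (fix-isFixedPoint n)))) , (λ n → proj₂ (proj₂ (proj₂ (fix-isFixedPoint n))))

    at0-fixₘ : at0 fixₘ ≈ₘ at0 A₀
    at0-fixₘ = Setoid.refl ≈ₘ-setoid

module Construction {c ℓ} (k : CommutativeRing c ℓ) {p : ℕ} (p>1 : 1 < p)
                    (Q Q⁻¹ : Mat2 k) (Q-inverse : IsInverse k Q Q⁻¹) where
  open Matrices k
  open Setoid ≈ₘ-setoid using (refl; trans)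
  open import Relation.Binary.Reasoning.Setoid ≈ₘ-setoid

  instance
    p≢0 : NonZero p
    p≢0 = ℕ.>-nonZero (ℕₚ.<-trans ℕₚ.0<1+n p>1)

  Q₀ Q₀⁻¹ : Mat2 k
  Q₀   = at0 Q
  Q₀⁻¹ = at0 Q⁻¹

  F : Mat2 k → Mat2 k
  F N = Q *ₘ phiₘ p N *ₘ Q₀⁻¹

  F-contracting : Contractingₘ F
  F-contracting A≈B = *ₘ-cong-≈[] (*ₘ-cong-≈[] (≈[]ₘ-refl Q) (phiₘ-contracting p>1 A≈B)) (≈[]ₘ-refl Q₀⁻¹)

  at0-F-Idₘ : at0 Idₘ ≈ₘ at0 (F Idₘ)
  at0-F-Idₘ = begin
    at0 Idₘ                          ≈⟨ at0-Idₘ ⟩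
    Idₘ                              ≈⟨ proj₁ (at0-inverse Q-inverse) ⟨
    Q₀ *ₘ Q₀⁻¹                       ≈⟨ *ₘ-cong (*ₘ-identityʳ Q₀) refl ⟨
    Q₀ *ₘ Idₘ *ₘ Q₀⁻¹                ≈⟨ *ₘ-cong (*ₘ-cong refl (trans (at0-phiₘ p Idₘ) at0-Idₘ)) refl ⟨
    Q₀ *ₘ at0 (phiₘ p Idₘ) *ₘ Q₀⁻¹   ≈⟨ *ₘ-cong (at0-*ₘ Q (phiₘ p Idₘ)) refl ⟨
    at0 (Q *ₘ phiₘ p Idₘ) *ₘ Q₀⁻¹    ≈⟨ at0-*ₘ (Q *ₘ phiₘ p Idₘ) Q₀⁻¹ ⟨
    at0 (F Idₘ)                      ∎

  open MatrixFixedPoint F F-contracting Idₘ at0-F-Idₘ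

  M : Mat2 k
  M = fixₘ

  M∈Id+XM2 : InId+XM2 k M
  M∈Id+XM2 = trans at0-fixₘ at0-Idₘ

  M⁻¹ : Mat2 k
  M⁻¹ = proj₁ (InId+XM2⇒InGL2 M M∈Id+XM2)

  M-inverse : IsInverse k M M⁻¹
  M-inverse = proj₂ (InId+XM2⇒InGL2 M M∈Id+XM2)

  M⁻¹QφM≈Q₀ : M⁻¹ *ₘ Q *ₘ phiₘ p M ≈ₘ Q₀
  M⁻¹QφM≈Q₀ = begin
    M⁻¹ *ₘ Q *ₘ phiₘ p M                     ≈⟨ *ₘ-assoc M⁻¹ Q (phiₘ p M) ⟩
    M⁻¹ *ₘ (Q *ₘ phiₘ p M)                   ≈⟨ *ₘ-cong refl (*ₘ-identityʳ _) ⟨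
    M⁻¹ *ₘ (Q *ₘ phiₘ p M *ₘ Idₘ)            ≈⟨ *ₘ-cong refl (*ₘ-cong refl (proj₂ (at0-inverse Q-inverse))) ⟨
    M⁻¹ *ₘ (Q *ₘ phiₘ p M *ₘ (Q₀⁻¹ *ₘ Q₀))   ≈⟨ *ₘ-cong refl (*ₘ-assoc _ Q₀⁻¹ Q₀) ⟨
    M⁻¹ *ₘ (F M *ₘ Q₀)                       ≈⟨ *ₘ-cong refl (*ₘ-cong fixₘ-isFixedPoint refl) ⟨
    M⁻¹ *ₘ (M *ₘ Q₀)                         ≈⟨ *ₘ-assoc M⁻¹ M Q₀ ⟨
    M⁻¹ *ₘ M *ₘ Q₀                           ≈⟨ *ₘ-cong (proj₂ M-inverse) refl ⟩
    Idₘ *ₘ Q₀                                ≈⟨ *ₘ-identityˡ Q₀ ⟩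
    Q₀                                       ∎

open Defs using (_≈ₘ_; _*ₘ_; phiₘ; at0)

mainTheorem10 : {c ℓ : Level} (k : CommutativeRing c ℓ) → IsFieldCR k → IsFinite k →
    (p : ℕ) → Prime p → HasCharacteristic k p →
    (Q : Mat2 k) → InGL2 k Q →
    Σ (Mat2 k) (λ M → InId+XM2 k M × Σ (Mat2 k) (λ Minv → IsInverse k M Minv
      × (_≈ₘ_ k (_*ₘ_ k (_*ₘ_ k Minv Q) (phiₘ k p M)) (at0 k Q))))
mainTheorem10 k _ _ p (prime _) _ Q (Q⁻¹ , Q-inverse) = M , M∈Id+XM2 , M⁻¹ , M-inverse , M⁻¹QφM≈Q₀
  where open Construction k (nonTrivial⇒n>1 p) Q Q⁻¹ Q-inverse
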